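{- Let $n=2^k+1$ with $k\ge 2$, let $T$ be a tour in the complete graph on $n$ vertices, and let $\mathcal{S}_t$ ($1\le t\le \log(n-1)-1$) be the sets of 2-changes constructed below. Then the 2-changes in $\mathcal{S}=\bigcup_{t=1}^{\log(n-1)-1}\mathcal{S}_t$ are pairwise chord-disjoint.
   Context: $\log$ is base 2. A tour is a Hamiltonian cycle; its edges are tour-edges, the other edges chord-edges. A 2-change $S_T(e,f)$, for non-adjacent tour-edges $e,f$, removes $e,f$ and adds the unique two chord-edges that reconnect the result into a new tour; two 2-changes are chord-disjoint if they add no common chord-edge. Construction: traverse $T$ from an arbitrary vertex in an arbitrary direction and label its edges $e_1,\dots,e_n$ in order; edge $e_j$ is at position $j$ (even if $j$ is even). The last edge $e_n$ is never used. At stage $t\in\{1,\dots,\log(n-1)-1\}$, split $e_1,\dots,e_{n-1}$ into $2^t$ consecutive segments $T_1,\dots,T_{2^t}$, each of $(n-1)/2^t$ edges; edges in odd-indexed segments are red and edges in even-indexed segments are blue in stage $t$. $\mathcal{S}_t$ is the set of all 2-changes $S_T(e,f)$ with $e$ in $T_i$ for some odd $i$ and $f$ an edge of $T_{i+1}$ at an even position along $T$. -}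

module Defs where

open import Data.Nat using (ℕ; zero; suc; _+_; _*_; _∸_; _^_; _≤_; _<_)
open import Data.Nat.Divisibility using (_∣_)
open import Data.Fin using (Fin; toℕ; inject₁; fromℕ) renaming (zero to fzero; suc to fsuc)
open import Data.Product using (Σ; ∃; _×_; _,_; proj₁; proj₂)
open import Data.Sum using (_⊎_)
open import Relation.Nullary using (¬_)
open import Relation.Binary.PropositionalEquality using (_≡_)
open import Function.Definitions using (Injective)
open import Function.Bundles using (_⇔_)

-- An (unordered) edge {a,b} is represented by an ordered pair; SameEdge says two
-- such pairs denote the same unordered pair.
Edge : ℕ → Set
Edge n = Fin n × Fin n

SameEdge : ∀ {n} → Edge n → Edge n → Set
SameEdge (a , b) (x , y) = (x ≡ a × y ≡ b) ⊎ (x ≡ b × y ≡ a)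

-- A tour on the vertex set Fin (suc m) is given by the order v 0, v 1, ..., v m in
-- which it is traversed (starting vertex and direction arbitrary); v must be
-- injective (hence a bijection).
IsTour : ∀ {m} → (Fin (suc m) → Fin (suc m)) → Set
IsTour v = Injective _≡_ _≡_ v

-- The tour edge at position  toℕ i + 1  (i : Fin m), i.e. e_{toℕ i + 1} = {v_i, v_{i+1}}.
-- (Positions 1 .. m = n-1; the last edge e_n = {v_m, v_0} is never used.)
posEdge : ∀ {m} → (Fin (suc m) → Fin (suc m)) → Fin m → Edge (suc m)
posEdge v i = v (inject₁ i) , v (fsuc i)

TourEdge : ∀ {m} → (Fin (suc m) → Fin (suc m)) → Edge (suc m) → Set
TourEdge {m} v g = (∃ λ i → SameEdge (posEdge v i) g) ⊎ SameEdge (v (fromℕ m) , v fzero) g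

ChordEdge : ∀ {m} → (Fin (suc m) → Fin (suc m)) → Edge (suc m) → Set
ChordEdge v g = ¬ (proj₁ g ≡ proj₂ g) × ¬ TourEdge v g

IsTourEdgeSet : ∀ {m} → (Edge (suc m) → Set) → Set
IsTourEdgeSet {m} E = ∃ λ (w : Fin (suc m) → Fin (suc m)) → IsTour w × (∀ g → (TourEdge w g ⇔ E g))

-- The 2-change S_T(e_p, e_q) (p = toℕ i + 1, q = toℕ j + 1): removes e_p and e_q
-- and adds the two chord-edges g, h; "Reconnects v i j g h" says g, h are
-- chord-edges such that the result is a new tour. (These two chord-edges are unique.)
Reconnects : ∀ {m} → (Fin (suc m) → Fin (suc m)) → Fin m → Fin m →
             Edge (suc m) → Edge (suc m) → Set
Reconnects v i j g h =
  ChordEdge v g × ChordEdge v h ×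
  IsTourEdgeSet (λ x →
    (TourEdge v x × ¬ SameEdge (posEdge v i) x × ¬ SameEdge (posEdge v j) x)
    ⊎ SameEdge g x ⊎ SameEdge h x)

-- Zero-based edge index i (position toℕ i + 1) lies in the zero-based segment a
-- of size s, i.e. in T_{a+1}.
InSeg : ℕ → ℕ → ℕ → Set
InSeg s a i = a * s ≤ i × i < suc a * s

-- Stage t with n - 1 = 2^k: segments have 2^(k-t) edges.  (e_p, e_q) ∈ S_t iff
-- e_p ∈ T_{2b+1} (odd index), e_q ∈ T_{2b+2}, and q is even.
InStage : (k t : ℕ) → Fin (2 ^ k) → Fin (2 ^ k) → Set
InStage k t i j =
  ∃ λ b → InSeg (2 ^ (k ∸ t)) (2 * b) (toℕ i)
        × InSeg (2 ^ (k ∸ t)) (suc (2 * b)) (toℕ j)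
        × 2 ∣ suc (toℕ j)

-- Membership in S = ⋃_{t=1}^{log(n-1)-1} S_t, where log(n-1) = k.
InS : (k : ℕ) → Fin (2 ^ k) → Fin (2 ^ k) → Set
InS k i j = ∃ λ t → 1 ≤ t × t ≤ k ∸ 1 × InStage k t i j

-- Number the vertices by their position 0, 1, …, n - 1 along T, so that e_{p+1} joins
-- the positions p and p + 1.  If e_{I+1} and e_{J+1} (I + 2 ≤ J) are removed, T falls
-- apart into the inner arc I + 1, …, J and the outer arc J + 1, …, n - 1, 0, …, I.  A new
-- tour has degree two everywhere, so each added chord joins two of the four loose ends,
-- one from each removed edge.  A "crossing" chord {I, J + 1} or {I + 1, J} stays inside
-- one arc: if both chords cross, the new tour cannot leave the inner arc, and if only
-- one does, it shares an endpoint with the other one, producing a vertex of degree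
-- three.  So the chords are {I, J} and {I + 1, J + 1}.  For a 2-change of S, J + 1 is
-- even (and I + 2 ≤ J because segments have even length), so an added chord {a, b},
-- a < b, determines the removed pair: it is (a, b) if b + 1 is even and (a - 1, b - 1)
-- otherwise.  Hence distinct 2-changes of S add distinct chords.

module Submission where

open import Defs
open import Data.Nat using (ℕ; zero; suc; _*_; _∸_; _^_; _≤_; _<_; z≤n; s≤s; _≟_)
open import Data.Nat.Properties
open import Data.Nat.Divisibility using (_∣_; ∣m+n∣m⇒∣n; ∣1⇒≡1; ∣n⇒∣m*n; m∣m*n)
open import Data.Fin using (Fin; toℕ; inject₁; fromℕ; fromℕ<; punchOut) renaming (zero to fzero; suc to fsuc)
open import Data.Fin.Properties
  using (toℕ-injective; toℕ-inject₁; toℕ-fromℕ; toℕ-fromℕ<; toℕ<n; punchOut-injective; injective⇒≤; any?)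
import Data.Fin.Properties as Fin
open import Data.Fin.Induction using (<-weakInduction)
open import Data.Product using (∃; ∃₂; _×_; _,_; proj₁; proj₂)
import Data.Product as Product
open import Data.Sum using (_⊎_; inj₁; inj₂; [_,_])
import Data.Sum as Sum
open import Data.Empty using (⊥; ⊥-elim)
open import Function using (_∘_; id)
open import Relation.Nullary using (¬_; Dec; yes; no)
open import Relation.Nullary.Decidable using (_×-dec_; _⊎-dec_)
open import Relation.Binary.PropositionalEquality using (_≡_; _≢_; refl; sym; trans; cong; subst)
open import Function.Definitions using (Injective)
open import Function.Bundles using (Equivalence; _⇔_)

injective⇒surjective : ∀ {n} (f : Fin n → Fin n) → Injective _≡_ _≡_ f → ∀ y → ∃ λ x → f x ≡ y
injective⇒surjective {zero} f f-inj ()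
injective⇒surjective {suc n} f f-inj y with any? (λ x → f x Fin.≟ y)
... | yes hit = hit
... | no miss = ⊥-elim (1+n≰n (injective⇒≤ squeeze-injective))
  where
    squeeze : Fin (suc n) → Fin n
    squeeze x = punchOut {i = y} {j = f x} (λ y≡fx → miss (x , sym y≡fx))

    squeeze-injective : Injective _≡_ _≡_ squeeze
    squeeze-injective eq = f-inj (punchOut-injective {i = y} _ _ eq)

2+n≰n : ∀ {n} → ¬ suc (suc n) ≤ n
2+n≰n = 1+n≰n ∘ ≤-trans (n≤1+n _)

consecutive-not-both-even : ∀ {n} → 2 ∣ n → 2 ∣ suc n → ⊥
consecutive-not-both-even {n} 2∣n 2∣1+n with ∣1⇒≡1 (∣m+n∣m⇒∣n (subst (2 ∣_) (+-comm 1 n) 2∣1+n) 2∣n)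
... | ()

-- Positions on the cycle 0, 1, …, m.

data Succ (m : ℕ) : ℕ → ℕ → Set where
  step : ∀ {a} → Succ m a (suc a)
  wrap : Succ m m zero

data Adjacent (m a b : ℕ) : Set where
  forward  : Succ m a b → Adjacent m a b
  backward : Succ m b a → Adjacent m a b

succ-functional : ∀ {m a b c} → b ≤ m → c ≤ m → Succ m a b → Succ m a c → b ≡ c
succ-functional _   _   step step = refl
succ-functional b≤m _   step wrap = ⊥-elim (1+n≰n b≤m)
succ-functional _   c≤m wrap step = ⊥-elim (1+n≰n c≤m)
succ-functional _   _   wrap wrap = refl

succ-injective : ∀ {m a b c} → Succ m b a → Succ m c a → b ≡ c
succ-injective step step = refl
succ-injective wrap wrap = refl

adjacent-at-most-two : ∀ {m a b c d} → b ≤ m → c ≤ m → d ≤ m →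
  Adjacent m a b → Adjacent m a c → Adjacent m a d → b ≡ c ⊎ b ≡ d ⊎ c ≡ d
adjacent-at-most-two b≤m c≤m _   (forward s)  (forward t)  _            = inj₁ (succ-functional b≤m c≤m s t)
adjacent-at-most-two _   _   _   (backward s) (backward t) _            = inj₁ (succ-injective s t)
adjacent-at-most-two b≤m _   d≤m (forward s)  (backward _) (forward u)  = inj₂ (inj₁ (succ-functional b≤m d≤m s u))
adjacent-at-most-two _   _   _   (backward s) (forward _)  (backward u) = inj₂ (inj₁ (succ-injective s u))
adjacent-at-most-two _   _   _   (forward _)  (backward t) (backward u) = inj₂ (inj₂ (succ-injective t u))
adjacent-at-most-two _   c≤m d≤m (backward _) (forward t)  (forward u)  = inj₂ (inj₂ (succ-functional c≤m d≤m t u))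

two-neighbours : ∀ {m p} → 2 ≤ m → p ≤ m →
  ∃₂ λ a b → Adjacent m p a × Adjacent m p b × a ≢ b × a ≤ m × b ≤ m
two-neighbours {m} {zero} 2≤m _ =
  1 , m , forward step , backward wrap , (λ 1≡m → <-irrefl 1≡m 2≤m) , ≤-trans (s≤s z≤n) 2≤m , ≤-refl
two-neighbours {m} {suc p} 2≤m p<m with suc p ≟ m
... | yes refl = p , 0 , backward step , forward wrap , (λ { refl → <-irrefl refl 2≤m }) , n≤1+n p , z≤n
... | no p+1≢m = p , suc (suc p) , backward step , forward step , (λ p≡p+2 → 2+n≰n (≤-reflexive (sym p≡p+2))) ,
                 ≤-trans (n≤1+n p) p<m , ≤∧≢⇒< p<m p+1≢m

Near : ℕ → ℕ → Set
Near K a = a ≡ K ⊎ a ≡ suc K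

Spans : ℕ → ℕ → ℕ → Set
Spans K a b = (a ≡ K × b ≡ suc K) ⊎ (a ≡ suc K × b ≡ K)

spans? : ∀ K a b → Dec (Spans K a b)
spans? K a b = ((a ≟ K) ×-dec (b ≟ suc K)) ⊎-dec ((a ≟ suc K) ×-dec (b ≟ K))

spans-near : ∀ {K a b} → Spans K a b → Near K a
spans-near = Sum.map proj₁ proj₁

spans-functional : ∀ {K a b c} → Spans K a b → Spans K a c → b ≡ c
spans-functional (inj₁ (_ , refl)) (inj₁ (_ , refl)) = refl
spans-functional (inj₂ (_ , refl)) (inj₂ (_ , refl)) = refl
spans-functional (inj₁ (refl , _)) (inj₂ (a≡1+a , _)) = ⊥-elim (1+n≰n (≤-reflexive (sym a≡1+a)))
spans-functional (inj₂ (refl , _)) (inj₁ (1+a≡a , _)) = ⊥-elim (1+n≰n (≤-reflexive 1+a≡a))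

spans-adjacent : ∀ {m K a b} → Spans K a b → Adjacent m a b
spans-adjacent (inj₁ (refl , refl)) = forward step
spans-adjacent (inj₂ (refl , refl)) = backward step

near-disjoint : ∀ {I J a} → suc (suc I) ≤ J → Near I a → Near J a → ⊥
near-disjoint gap (inj₁ refl) (inj₁ refl) = 2+n≰n gap
near-disjoint gap (inj₁ refl) (inj₂ refl) = 2+n≰n (≤-trans (n≤1+n _) gap)
near-disjoint gap (inj₂ refl) (inj₁ refl) = 1+n≰n gap
near-disjoint gap (inj₂ refl) (inj₂ refl) = 2+n≰n gap

near-near-adjacent : ∀ {m K a b} → Near K a → Near K b → a ≡ b ⊎ Adjacent m a b
near-near-adjacent (inj₁ refl) (inj₁ refl) = inj₁ refl
near-near-adjacent (inj₁ refl) (inj₂ refl) = inj₂ (forward step)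
near-near-adjacent (inj₂ refl) (inj₁ refl) = inj₂ (backward step)
near-near-adjacent (inj₂ refl) (inj₂ refl) = inj₁ refl

InnerArc : ℕ → ℕ → ℕ → Set
InnerArc I J a = suc I ≤ a × a ≤ J

adjacent-preserves-inner : ∀ {m I J a b} → J < m → Adjacent m a b → ¬ Spans I a b → ¬ Spans J a b →
  InnerArc I J a → InnerArc I J b
adjacent-preserves-inner {J = J} {a = a} J<m (forward step) _ ¬J (I<a , a≤J) with a ≟ J
... | yes refl = ⊥-elim (¬J (inj₁ (refl , refl)))
... | no a≢J = ≤-trans I<a (n≤1+n a) , ≤∧≢⇒< a≤J a≢J
adjacent-preserves-inner J<m (forward wrap) _ _ (_ , m≤J) = ⊥-elim (<-irrefl refl (≤-trans J<m m≤J))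
adjacent-preserves-inner {I = I} {b = b} _ (backward step) ¬I _ (I<1+b , 1+b≤J) with I ≟ b
... | yes refl = ⊥-elim (¬I (inj₂ (refl , refl)))
... | no I≢b = ≤∧≢⇒< (≤-pred I<1+b) I≢b , ≤-trans (n≤1+n b) 1+b≤J
adjacent-preserves-inner _ (backward wrap) _ _ (() , _)

-- The two ways of pairing the loose ends I, I + 1 and J, J + 1 of two removed tour edges.

data Parallel (I J : ℕ) : ℕ → ℕ → Set where
  lower : Parallel I J I J
  upper : Parallel I J (suc I) (suc J)

data Crossing (I J : ℕ) : ℕ → ℕ → Set where
  outer : Crossing I J I (suc J)
  inner : Crossing I J (suc I) J

parallel-or-crossing : ∀ {I J a b} → Near I a → Near J b → Parallel I J a b ⊎ Crossing I J a b
parallel-or-crossing (inj₁ refl) (inj₁ refl) = inj₁ lower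
parallel-or-crossing (inj₂ refl) (inj₂ refl) = inj₁ upper
parallel-or-crossing (inj₁ refl) (inj₂ refl) = inj₂ outer
parallel-or-crossing (inj₂ refl) (inj₁ refl) = inj₂ inner

crossing-preserves-inner : ∀ {I J a b} → I < J → Crossing I J a b →
  (InnerArc I J a → InnerArc I J b) × (InnerArc I J b → InnerArc I J a)
crossing-preserves-inner _   outer =
  (λ { (I<I , _) → ⊥-elim (<-irrefl refl I<I) }) , (λ { (_ , J<J) → ⊥-elim (<-irrefl refl J<J) })
crossing-preserves-inner I<J inner = (λ _ → I<J , ≤-refl) , (λ _ → ≤-refl , I<J)

crossing-meets-parallel : ∀ {I J a b a′ b′} → Crossing I J a b → Parallel I J a′ b′ →
  (a ≡ a′ × b ≢ b′) ⊎ (b ≡ b′ × a ≢ a′)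
crossing-meets-parallel outer lower = inj₁ (refl , 1+n≢n)
crossing-meets-parallel outer upper = inj₂ (refl , 1+n≢n ∘ sym)
crossing-meets-parallel inner lower = inj₂ (refl , 1+n≢n)
crossing-meets-parallel inner upper = inj₁ (refl , 1+n≢n ∘ sym)

Parallel± : ℕ → ℕ → ℕ → ℕ → Set
Parallel± I J a b = Parallel I J a b ⊎ Parallel I J b a

parallel-< : ∀ {I J a b} → I < J → Parallel I J a b → a < b
parallel-< I<J lower = I<J
parallel-< I<J upper = s≤s I<J

parallel-unique : ∀ {I J I′ J′ a b} → 2 ∣ suc J → 2 ∣ suc J′ →
  Parallel I J a b → Parallel I′ J′ a b → I ≡ I′ × J ≡ J′
parallel-unique _      _       lower lower = refl , refl
parallel-unique _      _       upper upper = refl , refl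
parallel-unique 2∣1+J  2∣1+J′  lower upper = ⊥-elim (consecutive-not-both-even 2∣1+J′ 2∣1+J)
parallel-unique 2∣1+J  2∣1+J′  upper lower = ⊥-elim (consecutive-not-both-even 2∣1+J 2∣1+J′)

parallel±-unique : ∀ {I J I′ J′ a b} → I < J → I′ < J′ → 2 ∣ suc J → 2 ∣ suc J′ →
  Parallel± I J a b → Parallel± I′ J′ a b → I ≡ I′ × J ≡ J′
parallel±-unique _ _ e e′ (inj₁ p) (inj₁ p′) = parallel-unique e e′ p p′
parallel±-unique _ _ e e′ (inj₂ p) (inj₂ p′) = parallel-unique e e′ p p′
parallel±-unique I<J I′<J′ _ _ (inj₁ p) (inj₂ p′) = ⊥-elim (<-asym (parallel-< I<J p) (parallel-< I′<J′ p′))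
parallel±-unique I<J I′<J′ _ _ (inj₂ p) (inj₁ p′) = ⊥-elim (<-asym (parallel-< I<J p) (parallel-< I′<J′ p′))

sameEdge-swap : ∀ {n} {e : Edge n} {x y} → SameEdge e (x , y) → SameEdge e (y , x)
sameEdge-swap = Sum.swap ∘ Sum.map Product.swap Product.swap

sameEdge-euclidean : ∀ {n} {e : Edge n} {x y x′ y′} →
  SameEdge e (x , y) → SameEdge e (x′ , y′) → SameEdge (x , y) (x′ , y′)
sameEdge-euclidean {e = a , b} = euclidean
  where
    euclidean : ∀ {x y x′ y′} →
      SameEdge (a , b) (x , y) → SameEdge (a , b) (x′ , y′) → SameEdge (x , y) (x′ , y′)
    euclidean (inj₁ (refl , refl)) (inj₁ (refl , refl)) = inj₁ (refl , refl)
    euclidean (inj₁ (refl , refl)) (inj₂ (refl , refl)) = inj₂ (refl , refl)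
    euclidean (inj₂ (refl , refl)) (inj₁ (refl , refl)) = inj₂ (refl , refl)
    euclidean (inj₂ (refl , refl)) (inj₂ (refl , refl)) = inj₁ (refl , refl)

module Tour {m : ℕ} (w : Fin (suc m) → Fin (suc m)) (w-tour : IsTour w) where

  private opaque
    index : Fin (suc m) → Fin (suc m)
    index x = proj₁ (injective⇒surjective w w-tour x)

    w-index : ∀ x → w (index x) ≡ x
    w-index x = proj₂ (injective⇒surjective w w-tour x)

  tourEdge-sym : ∀ {x y} → TourEdge w (x , y) → TourEdge w (y , x)
  tourEdge-sym = Sum.map (Product.map₂ sameEdge-swap) sameEdge-swap

  pos : Fin (suc m) → ℕ
  pos x = toℕ (index x)

  pos-injective : ∀ {x y} → pos x ≡ pos y → x ≡ y
  pos-injective {x} {y} eq = trans (sym (w-index x)) (trans (cong w (toℕ-injective eq)) (w-index y))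

  pos-w : ∀ p → pos (w p) ≡ toℕ p
  pos-w p = cong toℕ (w-tour (w-index (w p)))

  pos≤m : ∀ x → pos x ≤ m
  pos≤m x = ≤-pred (toℕ<n (index x))

  pos-surjective : ∀ {p} → p ≤ m → ∃ λ x → pos x ≡ p
  pos-surjective p≤m = w (fromℕ< (s≤s p≤m)) , trans (pos-w _) (toℕ-fromℕ< (s≤s p≤m))

  at-pos : ∀ {x} p → pos x ≡ toℕ p → x ≡ w p
  at-pos p eq = pos-injective (trans eq (sym (pos-w p)))

  posEdge-spans : ∀ k {x y} → SameEdge (posEdge w k) (x , y) → Spans (toℕ k) (pos x) (pos y)
  posEdge-spans k (inj₁ (refl , refl)) = inj₁ (trans (pos-w (inject₁ k)) (toℕ-inject₁ k) , pos-w (fsuc k))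
  posEdge-spans k (inj₂ (refl , refl)) = inj₂ (pos-w (fsuc k) , trans (pos-w (inject₁ k)) (toℕ-inject₁ k))

  spans-posEdge : ∀ k {x y} → Spans (toℕ k) (pos x) (pos y) → SameEdge (posEdge w k) (x , y)
  spans-posEdge k (inj₁ (ex , ey)) = inj₁ (at-pos (inject₁ k) (trans ex (sym (toℕ-inject₁ k))) , at-pos (fsuc k) ey)
  spans-posEdge k (inj₂ (ex , ey)) = inj₂ (at-pos (fsuc k) ex , at-pos (inject₁ k) (trans ey (sym (toℕ-inject₁ k))))

  tourEdge⇒adjacent : ∀ {x y} → TourEdge w (x , y) → Adjacent m (pos x) (pos y)
  tourEdge⇒adjacent (inj₁ (k , same)) = spans-adjacent (posEdge-spans k same)
  tourEdge⇒adjacent (inj₂ same) = along same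
    where
      closing : Succ m (pos (w (fromℕ m))) (pos (w fzero))
      closing rewrite pos-w (fromℕ m) | pos-w fzero | toℕ-fromℕ m = wrap

      along : ∀ {x y} → SameEdge (w (fromℕ m) , w fzero) (x , y) → Adjacent m (pos x) (pos y)
      along (inj₁ (refl , refl)) = forward closing
      along (inj₂ (refl , refl)) = backward closing

  succ⇒tourEdge : ∀ {x y a b} → Succ m a b → pos x ≡ a → pos y ≡ b → TourEdge w (x , y)
  succ⇒tourEdge {x} {y} step refl eb =
    inj₁ (k , spans-posEdge k (inj₁ (sym (toℕ-fromℕ< a<m) , trans eb (cong suc (sym (toℕ-fromℕ< a<m))))))
    where
      a<m : pos x < m
      a<m = subst (_≤ m) eb (pos≤m y)

      k : Fin m
      k = fromℕ< a<m
  succ⇒tourEdge wrap ea eb = inj₂ (inj₁ (at-pos (fromℕ m) (trans ea (sym (toℕ-fromℕ m))) , at-pos fzero eb))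

  adjacent⇒tourEdge : ∀ {x y} → Adjacent m (pos x) (pos y) → TourEdge w (x , y)
  adjacent⇒tourEdge {x} {y} (forward s)  = succ⇒tourEdge {x} {y} s refl refl
  adjacent⇒tourEdge {x} {y} (backward s) = tourEdge-sym (succ⇒tourEdge {y} {x} s refl refl)

  degree≤2 : ∀ {x a b c} → TourEdge w (x , a) → TourEdge w (x , b) → TourEdge w (x , c) →
    a ≡ b ⊎ a ≡ c ⊎ b ≡ c
  degree≤2 {a = a} {b} {c} ta tb tc =
    Sum.map pos-injective (Sum.map pos-injective pos-injective)
      (adjacent-at-most-two (pos≤m a) (pos≤m b) (pos≤m c)
        (tourEdge⇒adjacent ta) (tourEdge⇒adjacent tb) (tourEdge⇒adjacent tc))

  two-tour-neighbours : 2 ≤ m → ∀ x →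
    ∃₂ λ y z → Adjacent m (pos x) (pos y) × Adjacent m (pos x) (pos z) × y ≢ z
  two-tour-neighbours 2≤m x with two-neighbours 2≤m (pos≤m x)
  ... | a , b , adj-a , adj-b , a≢b , a≤m , b≤m with pos-surjective a≤m | pos-surjective b≤m
  ...   | y , refl | z , refl = y , z , adj-a , adj-b , a≢b ∘ cong pos

  connected : (P : Fin (suc m) → Set) → (∀ {x y} → TourEdge w (x , y) → P x → P y) →
    ∀ {x} → P x → ∀ y → P y
  connected P closed {x} Px y = subst P (w-index y) (from-start (index y))
    where
      to-start : ∀ p → P (w p) → P (w fzero)
      to-start = <-weakInduction (λ p → P (w p) → P (w fzero)) id
        (λ k back → back ∘ closed (inj₁ (k , inj₂ (refl , refl))))

      from-start : ∀ p → P (w p)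
      from-start = <-weakInduction (P ∘ w) (to-start (index x) (subst P (sym (w-index x)) Px))
        (λ k → closed (inj₁ (k , inj₁ (refl , refl))))

  ParallelChord : ℕ → ℕ → Edge (suc m) → Set
  ParallelChord I J (x , y) = Parallel± I J (pos x) (pos y)

  parallelChord-unique : ∀ {I J I′ J′ c c′} → I < J → I′ < J′ → 2 ∣ suc J → 2 ∣ suc J′ →
    ParallelChord I J c → ParallelChord I′ J′ c′ → SameEdge c c′ → I ≡ I′ × J ≡ J′
  parallelChord-unique {c = _ , _} {c′ = _ , _} I<J I′<J′ e e′ p p′ (inj₁ (refl , refl)) =
    parallel±-unique I<J I′<J′ e e′ p p′
  parallelChord-unique {c = _ , _} {c′ = _ , _} I<J I′<J′ e e′ p p′ (inj₂ (refl , refl)) =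
    parallel±-unique I<J I′<J′ e e′ p (Sum.swap p′)

  parallel-chords-disjoint : ∀ {I J I′ J′ g h g′ h′} → I < J → I′ < J′ → 2 ∣ suc J → 2 ∣ suc J′ →
    ParallelChord I J g × ParallelChord I J h → ParallelChord I′ J′ g′ × ParallelChord I′ J′ h′ →
    SameEdge g g′ ⊎ SameEdge g h′ ⊎ SameEdge h g′ ⊎ SameEdge h h′ → I ≡ I′ × J ≡ J′
  parallel-chords-disjoint {I} {J} {I′} {J′} I<J I′<J′ e e′ (pg , ph) (pg′ , ph′) =
    [ meet pg pg′ , [ meet pg ph′ , [ meet ph pg′ , meet ph ph′ ] ] ]
    where
      meet : ∀ {c c′} → ParallelChord I J c → ParallelChord I′ J′ c′ → SameEdge c c′ → I ≡ I′ × J ≡ J′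
      meet = parallelChord-unique I<J I′<J′ e e′

NewEdge : ∀ {m} → (Fin (suc m) → Fin (suc m)) → Fin m → Fin m → Edge (suc m) → Edge (suc m) →
  Edge (suc m) → Set
NewEdge v i j g h e =
  (TourEdge v e × ¬ SameEdge (posEdge v i) e × ¬ SameEdge (posEdge v j) e) ⊎ SameEdge g e ⊎ SameEdge h e

module TwoChange {m : ℕ} (v : Fin (suc m) → Fin (suc m)) (v-tour : IsTour v)
                 (i j : Fin m) (gap : suc (suc (toℕ i)) ≤ toℕ j)
                 (g h : Edge (suc m)) (g-chord : ChordEdge v g) (h-chord : ChordEdge v h)
                 (w : Fin (suc m) → Fin (suc m)) (w-tour : IsTour w)
                 (w-edges : ∀ e → TourEdge w e ⇔ NewEdge v i j g h e) where

  open Tour v v-tour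
  private module New = Tour w w-tour

  I J : ℕ
  I = toℕ i
  J = toℕ j

  I<J : I < J
  I<J = ≤-trans (n≤1+n _) gap

  2+I≤m : suc (suc I) ≤ m
  2+I≤m = ≤-trans gap (<⇒≤ (toℕ<n j))

  2≤m : 2 ≤ m
  2≤m = ≤-trans (s≤s (s≤s z≤n)) 2+I≤m

  New : Edge (suc m) → Set
  New = NewEdge v i j g h

  new-sym : ∀ {x y} → New (x , y) → New (y , x)
  new-sym = Sum.map (Product.map tourEdge-sym (Product.map (_∘ sameEdge-swap) (_∘ sameEdge-swap)))
                    (Sum.map sameEdge-swap sameEdge-swap)

  new-degree≤2 : ∀ {x a b c} → New (x , a) → New (x , b) → New (x , c) → a ≡ b ⊎ a ≡ c ⊎ b ≡ c
  new-degree≤2 na nb nc = New.degree≤2 (tour na) (tour nb) (tour nc)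
    where
      tour : ∀ {e} → New e → TourEdge w e
      tour {e} = Equivalence.from (w-edges e)

  new-connected : (P : Fin (suc m) → Set) → (∀ {x y} → New (x , y) → P x → P y) → ∀ {x} → P x → ∀ y → P y
  new-connected P closed = New.connected P (λ {x} {y} t → closed (Equivalence.to (w-edges (x , y)) t))

  Removed : ℕ → ℕ → Set
  Removed a b = Spans I a b ⊎ Spans J a b

  removed? : ∀ a b → Dec (Removed a b)
  removed? a b = spans? I a b ⊎-dec spans? J a b

  removed-near : ∀ {a b} → Removed a b → Near I a ⊎ Near J a
  removed-near = Sum.map spans-near spans-near

  removed-functional : ∀ {p a b} → Removed p a → Removed p b → a ≡ b
  removed-functional (inj₁ s) (inj₁ t) = spans-functional s t
  removed-functional (inj₂ s) (inj₂ t) = spans-functional s t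
  removed-functional (inj₁ s) (inj₂ t) = ⊥-elim (near-disjoint gap (spans-near s) (spans-near t))
  removed-functional (inj₂ s) (inj₁ t) = ⊥-elim (near-disjoint gap (spans-near t) (spans-near s))

  kept : ∀ {x y} → Adjacent m (pos x) (pos y) → ¬ Removed (pos x) (pos y) → New (x , y)
  kept adj ¬removed =
    inj₁ (adjacent⇒tourEdge adj , ¬removed ∘ inj₁ ∘ posEdge-spans i , ¬removed ∘ inj₂ ∘ posEdge-spans j)

  kept-neighbour : ∀ x → ∃ λ y → Adjacent m (pos x) (pos y) × ¬ Removed (pos x) (pos y)
  kept-neighbour x with two-tour-neighbours 2≤m x
  ... | y , z , adj-y , adj-z , y≢z with removed? (pos x) (pos y)
  ...   | no ¬removed = y , adj-y , ¬removed
  ...   | yes removed = z , adj-z , y≢z ∘ pos-injective ∘ removed-functional removed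

  chord-end-near : ∀ {x y} → New (x , y) → ¬ TourEdge v (x , y) → Near I (pos x) ⊎ Near J (pos x)
  chord-end-near {x} new ¬tour with two-tour-neighbours 2≤m x
  ... | a , b , adj-a , adj-b , a≢b with removed? (pos x) (pos a) | removed? (pos x) (pos b)
  ...   | yes removed | _           = removed-near removed
  ...   | no _        | yes removed = removed-near removed
  ...   | no ¬ra      | no ¬rb with new-degree≤2 new (kept adj-a ¬ra) (kept adj-b ¬rb)
  ...     | inj₁ refl        = ⊥-elim (¬tour (adjacent⇒tourEdge adj-a))
  ...     | inj₂ (inj₁ refl) = ⊥-elim (¬tour (adjacent⇒tourEdge adj-b))
  ...     | inj₂ (inj₂ a≡b)  = ⊥-elim (a≢b a≡b)

  two-chords-at : ∀ {x x′ y z} → x ≡ x′ → New (x , y) → New (x′ , z) →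
    ¬ TourEdge v (x , y) → ¬ TourEdge v (x′ , z) → pos y ≢ pos z → ⊥
  two-chords-at {x} refl ny nz ¬ty ¬tz y≢z =
    let u , adj , ¬removed = kept-neighbour x in
    [ y≢z ∘ cong pos
    , [ (λ { refl → ¬ty (adjacent⇒tourEdge adj) }) , (λ { refl → ¬tz (adjacent⇒tourEdge adj) }) ] ]
      (new-degree≤2 ny nz (kept adj ¬removed))

  chord-ends-apart : ∀ {K x y} → ChordEdge v (x , y) → Near K (pos x) → Near K (pos y) → ⊥
  chord-ends-apart (x≢y , ¬tour) nx ny =
    [ x≢y ∘ pos-injective , ¬tour ∘ adjacent⇒tourEdge ] (near-near-adjacent nx ny)

  record Oriented (c : Edge (suc m)) : Set where
    field
      {from to} : Fin (suc m)
      same      : SameEdge c (from , to)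
      new       : New (from , to)
      not-tour  : ¬ TourEdge v (from , to)
      from-near : Near I (pos from)
      to-near   : Near J (pos to)

    shape : Parallel I J (pos from) (pos to) ⊎ Crossing I J (pos from) (pos to)
    shape = parallel-or-crossing from-near to-near

  open Oriented

  orient : ∀ {x y} → ChordEdge v (x , y) → New (x , y) → Oriented (x , y)
  orient {x} {y} chord@(_ , ¬tour) new =
    by-sides (chord-end-near new ¬tour) (chord-end-near (new-sym new) (¬tour ∘ tourEdge-sym))
    where
      by-sides : Near I (pos x) ⊎ Near J (pos x) → Near I (pos y) ⊎ Near J (pos y) → Oriented (x , y)
      by-sides (inj₁ near-x) (inj₂ near-y) = record
        { same = inj₁ (refl , refl) ; new = new ; not-tour = ¬tour ; from-near = near-x ; to-near = near-y }
      by-sides (inj₂ near-x) (inj₁ near-y) = record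
        { same = inj₂ (refl , refl) ; new = new-sym new ; not-tour = ¬tour ∘ tourEdge-sym
        ; from-near = near-y ; to-near = near-x }
      by-sides (inj₁ near-x) (inj₁ near-y) = ⊥-elim (chord-ends-apart chord near-x near-y)
      by-sides (inj₂ near-x) (inj₂ near-y) = ⊥-elim (chord-ends-apart chord near-x near-y)

  no-crossing-with-parallel : ∀ {c c′} (o : Oriented c) (o′ : Oriented c′) →
    Crossing I J (pos (from o)) (pos (to o)) → Parallel I J (pos (from o′)) (pos (to o′)) → ⊥
  no-crossing-with-parallel o o′ cross par with crossing-meets-parallel cross par
  ... | inj₁ (from≡ , to≢) = two-chords-at (pos-injective from≡) (new o) (new o′) (not-tour o) (not-tour o′) to≢
  ... | inj₂ (to≡ , from≢) = two-chords-at (pos-injective to≡) (new-sym (new o)) (new-sym (new o′))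
                               (not-tour o ∘ tourEdge-sym) (not-tour o′ ∘ tourEdge-sym) from≢

  crossings-disconnect : (og : Oriented g) (oh : Oriented h) →
    Crossing I J (pos (from og)) (pos (to og)) → Crossing I J (pos (from oh)) (pos (to oh)) → ⊥
  crossings-disconnect og oh cg ch with pos-surjective (≤-trans (n≤1+n (suc I)) 2+I≤m) | pos-surjective {0} z≤n
  ... | start , pos-start | end , pos-end =
    n≮0 (subst (suc I ≤_) pos-end (proj₁ (new-connected Inside closed start-inside end)))
    where
      Inside : Fin (suc m) → Set
      Inside x = InnerArc I J (pos x)

      start-inside : Inside start
      start-inside = ≤-reflexive (sym pos-start) , subst (_≤ J) (sym pos-start) I<J

      along : ∀ {c x y} (o : Oriented c) → Crossing I J (pos (from o)) (pos (to o)) →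
        SameEdge c (x , y) → Inside x → Inside y
      along o cross s with sameEdge-euclidean (same o) s
      ... | inj₁ (refl , refl) = proj₁ (crossing-preserves-inner I<J cross)
      ... | inj₂ (refl , refl) = proj₂ (crossing-preserves-inner I<J cross)

      closed : ∀ {x y} → New (x , y) → Inside x → Inside y
      closed (inj₁ (t , ¬i , ¬j)) =
        adjacent-preserves-inner (toℕ<n j) (tourEdge⇒adjacent t) (¬i ∘ spans-posEdge i) (¬j ∘ spans-posEdge j)
      closed (inj₂ (inj₁ s)) = along og cg s
      closed (inj₂ (inj₂ s)) = along oh ch s

  parallel-chord : ∀ {c} (o : Oriented c) → Parallel I J (pos (from o)) (pos (to o)) → ParallelChord I J c
  parallel-chord o par = Sum.map move move (same o)
    where
      move : ∀ {x y} → from o ≡ x × to o ≡ y → Parallel I J (pos x) (pos y)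
      move (refl , refl) = par

  oriented-parallel : Oriented g → Oriented h → ParallelChord I J g × ParallelChord I J h
  oriented-parallel og oh with shape og | shape oh
  ... | inj₁ pg | inj₁ ph = parallel-chord og pg , parallel-chord oh ph
  ... | inj₁ pg | inj₂ ch = ⊥-elim (no-crossing-with-parallel oh og ch pg)
  ... | inj₂ cg | inj₁ ph = ⊥-elim (no-crossing-with-parallel og oh cg ph)
  ... | inj₂ cg | inj₂ ch = ⊥-elim (crossings-disconnect og oh cg ch)

  chords-parallel : ParallelChord I J g × ParallelChord I J h
  chords-parallel = oriented-parallel (orient g-chord (inj₂ (inj₁ (inj₁ (refl , refl)))))
                                      (orient h-chord (inj₂ (inj₂ (inj₁ (refl , refl)))))

reconnected-chords-parallel : ∀ {m} {v : Fin (suc m) → Fin (suc m)} (v-tour : IsTour v) {i j : Fin m} {g h} →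
  suc (suc (toℕ i)) ≤ toℕ j → Reconnects v i j g h →
  Tour.ParallelChord v v-tour (toℕ i) (toℕ j) g × Tour.ParallelChord v v-tour (toℕ i) (toℕ j) h
reconnected-chords-parallel {v = v} v-tour {i} {j} {g} {h} gap (g-chord , h-chord , w , w-tour , w-edges) =
  TwoChange.chords-parallel v v-tour i j gap g h g-chord h-chord w w-tour w-edges

segment-size-even : ∀ {k t} → 2 ≤ k → 1 ≤ t → t ≤ k ∸ 1 → 2 ∣ 2 ^ (k ∸ t)
segment-size-even {suc (suc k)} {suc t} _ _ t≤k rewrite +-∸-assoc 1 (≤-pred t≤k) = m∣m*n (2 ^ (k ∸ t))

segment-pair-separated : ∀ {s b I J} → 2 ∣ s → InSeg s (2 * b) I → InSeg s (suc (2 * b)) J → 2 ∣ suc J →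
  suc (suc I) ≤ J
segment-pair-separated {s} {b} {I} {J} 2∣s (_ , I<X) (X≤J , _) 2∣1+J with suc (2 * b) * s ≟ J
... | yes X≡J = ⊥-elim (consecutive-not-both-even (subst (2 ∣_) X≡J (∣n⇒∣m*n (suc (2 * b)) 2∣s)) 2∣1+J)
... | no X≢J = ≤-trans (s≤s I<X) (≤∧≢⇒< X≤J X≢J)

inS-separated : ∀ {k i j} → 2 ≤ k → InS k i j → suc (suc (toℕ i)) ≤ toℕ j
inS-separated 2≤k (t , 1≤t , t≤k-1 , b , i∈T , j∈T′ , even) =
  segment-pair-separated {b = b} (segment-size-even 2≤k 1≤t t≤k-1) i∈T j∈T′ even

inS-even : ∀ {k i j} → InS k i j → 2 ∣ suc (toℕ j)
inS-even (_ , _ , _ , _ , _ , _ , even) = even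

lemma12 : (k : ℕ) → 2 ≤ k →
    (v : Fin (suc (2 ^ k)) → Fin (suc (2 ^ k))) → IsTour v →
    (i j i′ j′ : Fin (2 ^ k)) → InS k i j → InS k i′ j′ →
    ¬ (i ≡ i′ × j ≡ j′) →
    (g h g′ h′ : Edge (suc (2 ^ k))) →
    Reconnects v i j g h → Reconnects v i′ j′ g′ h′ →
    ¬ (SameEdge g g′ ⊎ SameEdge g h′ ⊎ SameEdge h g′ ⊎ SameEdge h h′)
lemma12 k 2≤k v v-tour i j i′ j′ ij∈S i′j′∈S distinct g h g′ h′ rec rec′ =
  distinct ∘ Product.map toℕ-injective toℕ-injective ∘
    parallel-chords-disjoint (≤-trans (n≤1+n _) gap) (≤-trans (n≤1+n _) gap′)
      (inS-even ij∈S) (inS-even i′j′∈S)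
      (reconnected-chords-parallel v-tour gap rec) (reconnected-chords-parallel v-tour gap′ rec′)
  where
    open Tour v v-tour using (parallel-chords-disjoint)

    gap : suc (suc (toℕ i)) ≤ toℕ j
    gap = inS-separated 2≤k ij∈S

    gap′ : suc (suc (toℕ i′)) ≤ toℕ j′
    gap′ = inS-separated 2≤k i′j′∈S
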